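{- Let $M$ be a positive integer with $M\equiv 1\pmod 8$. If $(M|7)=-1$, then \[ (1,8,8,0,0,0)(M)= 4(3,5,14,0,0,2)(M). \] If $7\,\|\,M$, then \[ (1,8,8,0,0,0)(M)=8(3,5,14,0,0,2)(M). \]
   Context: For integers $a,b,c,d,e,f$, $(a,b,c,d,e,f)(M):=|\{(x,y,z)\in\mathbb Z^3: M=ax^2+by^2+cz^2+dyz+ezx+fxy\}|$. $(M|7)$ is the Legendre/Jacobi symbol. $7\,\|\,M$ means $7\mid M$ but $7^2\nmid M$. -}

module Defs where

open import Data.Nat as ℕ using (ℕ; zero; suc; _%_)
open import Data.Integer as ℤ using (ℤ; +_; _+_; _*_; -_)
open import Data.List using (List; []; _∷_; length; filter; map; concatMap; upTo)
open import Data.Product using (_×_; _,_; Σ; ∃)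
open import Relation.Binary.PropositionalEquality using (_≡_)
open import Relation.Nullary using (¬_)
open import Data.Integer.Divisibility using () renaming (_∣_ to _∣ℤ_)
import Data.Integer.Properties as ℤP

range : ℕ → List ℤ
range n = map (λ i → (+ i) + (- (+ n))) (upTo (2 ℕ.* n ℕ.+ 1))

Q : (a b c d e f : ℤ) → ℤ → ℤ → ℤ → ℤ
Q a b c d e f x y z =
  a * x * x + b * y * y + c * z * z + d * y * z + e * z * x + f * x * y

reps : (a b c d e f : ℤ) → ℕ → ℕ
reps a b c d e f M =
  length (filter (λ t → Q a b c d e f (proj₁' t) (proj₂₁ t) (proj₂₂ t) ℤ.≟ (+ M)) triples)
  where
  triples : List (ℤ × ℤ × ℤ)
  triples = concatMap (λ x → concatMap (λ y → map (λ z → x , y , z) (range M)) (range M)) (range M)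
  proj₁' : ℤ × ℤ × ℤ → ℤ
  proj₁' (x , _ , _) = x
  proj₂₁ : ℤ × ℤ × ℤ → ℤ
  proj₂₁ (_ , y , _) = y
  proj₂₂ : ℤ × ℤ × ℤ → ℤ
  proj₂₂ (_ , _ , z) = z

LegendreMinus1mod7 : ℕ → Set
LegendreMinus1mod7 M = ¬ (M % 7 ≡ 0) × ¬ (∃ λ x → (x ℕ.* x) % 7 ≡ M % 7)

open import Data.Nat.Divisibility using (_∣_)
SevenExactly : ℕ → Set
SevenExactly M = (7 ∣ M) × ¬ (49 ∣ M)

module Submission where

-- Let Λ₇ = {v : 7 ∣ x + 3y + 5z} and Λ₄ = {w : w₂ and w₁ + w₂ + w₃ even}.  A
-- linear bijection φ : Λ₇ → Λ₄ satisfies G ∘ φ = F, where F = x² + 8y² + 8z² and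
-- G = 3x² + 5y² + 14z² + 2xy; when M ≡ 1 (mod 8) every representation of M by G
-- lies in Λ₄, so r_G(M) counts the representations of M by F lying in Λ₇.  The
-- eight signed permutations σ of (y, z) are isometries of F, so for each of them
-- r_G(M) also counts the representations v with σ v ∈ Λ₇.  Counting the pairs
-- (σ, v) with F v = M and σ v ∈ Λ₇ in two ways gives k · r_F(M) = 8 · r_G(M) if
-- every representation has exactly k of its eight images in Λ₇.  That number
-- depends only on v mod 7, and a check of all residues gives k = 2 when M is a
-- non-residue mod 7, and k = 1 when 7 ∥ M (v ≡ 0 mod 7 would force 49 ∣ M).

open import Defs

-- The development lives in an anonymous module so that its integer operators
-- stay out of scope of the statement, whose operators are those of ℕ.
module _ where
  open import Data.Nat as ℕ using (ℕ)
  open import Data.Integer using (ℤ; +_)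
  open import Data.Product using (_×_; _,_)

  -- The polynomial maps of the proof are written once over an arbitrary ring
  -- signature: instantiated at ℤ they are the maps themselves, instantiated at
  -- the ring solver's syntax they let the solver verify identities between them,
  -- and instantiated at congruent pairs they show that they respect congruences.
  record RingOps (A : Set) : Set where
    infixl 6 _+_ _-_
    infixl 7 _*_
    infix 8 #_
    field
      _+_ _-_ _*_ : A → A → A
      #_ : ℕ → A

  module Forms {A : Set} (ops : RingOps A) where
    open RingOps ops

    Point : Set
    Point = A × A × A

    form : (a b c d e f : ℕ) → Point → A
    form a b c d e f (x , y , z) =
      # a * x * x + # b * y * y + # c * z * z + # d * y * z + # e * z * x + # f * x * y

    F G : Point → A
    F = form 1 8 8 0 0 0
    G = form 3 5 14 0 0 2

    ℓ : Point → A
    ℓ (x , y , z) = x + # 3 * y + # 5 * z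

    norm² : Point → A
    norm² (x , y , z) = x * x + y * y + z * z

    -- Parametrisations of Λ₇ and Λ₄, and the linear change of parameters
    -- between them.
    plane lattice α β : Point → Point
    plane (k , y , z) = # 7 * k - # 3 * y - # 5 * z , y , z
    lattice (w , h , g) = w , # 2 * h , # 2 * g - w - # 2 * h
    α (k , y , z) = # 3 * k - y - z , z - k , z
    β (w , h , g) = g - h , # 2 * g - w - # 3 * h , g

  open import Algebra.Definitions using (Involutive)
  open import Data.Bool using (Bool; true; false; if_then_else_)
  open import Data.Empty using (⊥-elim)
  open import Data.Fin using (Fin; toℕ; fromℕ<)
  open import Data.Fin.Properties using (all?; any?; toℕ-fromℕ<)
  open import Data.Integer as ℤ using (_+_; _-_; _*_; -_; 0ℤ; _≤_; +≤+; -≤+; -[1+_])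
  import Data.Integer.Properties as ℤ
  open import Data.Integer.DivMod using (_%ℕ_; _/ℕ_; n%ℕd<d; a≡a%ℕn+[a/ℕn]*n)
  open import Data.Integer.Divisibility.Signed
    using (_∣_; _∣?_; divides; ∣-trans; ∣m∣n⇒∣m+n; ∣m∣n⇒∣m-n; ∣m⇒∣-m; ∣n⇒∣m*n; ∣m⇒∣m*n; ∣⇒∣ᵤ; ∣ᵤ⇒∣)
  open import Data.Integer.Solver using (module +-*-Solver)
  open import Data.Integer.Tactic.RingSolver using (solve-∀)
  import Data.Nat.Tactic.RingSolver as ℕ-Solver
  open import Data.List using (List; []; _∷_; _++_; length; filter; map; concatMap; upTo; cartesianProduct)
  open import Data.List.Membership.Propositional using (_∈_)
  open import Data.List.Membership.Propositional.Properties
    using (∈-map⁺; ∈-map⁻; ∈-++⁺ˡ; ∈-++⁺ʳ; ∈-++⁻; ∈-∃++; ∈-concat⁺′; ∈-concat⁻′; ∈-upTo⁺; ∈-filter⁺; ∈-filter⁻)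
  open import Data.List.Properties using (length-++; map-cong; filter-≐)
  open import Data.List.Relation.Binary.Disjoint.Propositional using (Disjoint)
  open import Data.List.Relation.Unary.All as All using ()
  open import Data.List.Relation.Unary.Any using (here; there)
  open import Data.List.Relation.Unary.Unique.Propositional using (Unique; []; _∷_)
  import Data.List.Relation.Unary.Unique.Propositional.Properties as Unique
  open import Data.Nat.ListAction using (sum)
  import Data.Nat.Properties as ℕ
  open import Data.Product using (Σ; ∃; proj₁; proj₂)
  open import Data.Sum as Sum using (_⊎_; inj₁; inj₂; [_,_]′)
  open import Function using (id; _∘_)
  open import Level using (0ℓ)
  open import Relation.Binary.PropositionalEquality
  open import Relation.Nullary using (Dec; yes; no; does; ¬_; ¬?)
  open import Relation.Nullary.Decidable using (_×-dec_; _⊎-dec_; _→-dec_; map′; toWitness)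
  open import Relation.Unary using (Pred; Decidable; _⊆_)
  open +-*-Solver using (solve; _:=_; con; _:+_; _:*_; _:-_; :-_; Polynomial)

  ℤ-ops : RingOps ℤ
  ℤ-ops = record { _+_ = _+_ ; _-_ = _-_ ; _*_ = _*_ ; #_ = +_ }

  open Forms ℤ-ops public

  syntax-ops : ∀ {m} → RingOps (Polynomial m)
  syntax-ops = record { _+_ = _:+_ ; _-_ = _:-_ ; _*_ = _:*_ ; #_ = λ n → con (+ n) }

  module Syntax {m} = Forms (syntax-ops {m})

  -- Congruences

  infix 4 _≡_[mod_] _≈_[mod_]

  record _≡_[mod_] (a b : ℤ) (n : ℕ) : Set where
    constructor ≡-mod
    field ∣-diff : + n ∣ a - b

  open _≡_[mod_]

  module _ {n : ℕ} where

    ≡-mod-refl : ∀ {a} → a ≡ a [mod n ]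
    ≡-mod-refl {a} = ≡-mod (divides 0ℤ (ℤ.+-inverseʳ a))

    ≡-mod-sym : ∀ {a b} → a ≡ b [mod n ] → b ≡ a [mod n ]
    ≡-mod-sym {a} {b} (≡-mod p) = ≡-mod (subst (+ n ∣_) (eq a b) (∣m⇒∣-m p))
      where
      eq : ∀ a b → - (a - b) ≡ b - a
      eq = solve-∀

    ≡-mod-trans : ∀ {a b c} → a ≡ b [mod n ] → b ≡ c [mod n ] → a ≡ c [mod n ]
    ≡-mod-trans {a} {b} {c} (≡-mod p) (≡-mod q) = ≡-mod (subst (+ n ∣_) (eq a b c) (∣m∣n⇒∣m+n p q))
      where
      eq : ∀ a b c → (a - b) + (b - c) ≡ a - c
      eq = solve-∀

    ≡-mod-+ : ∀ {a b c d} → a ≡ b [mod n ] → c ≡ d [mod n ] → a + c ≡ b + d [mod n ]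
    ≡-mod-+ {a} {b} {c} {d} (≡-mod p) (≡-mod q) = ≡-mod (subst (+ n ∣_) (eq a b c d) (∣m∣n⇒∣m+n p q))
      where
      eq : ∀ a b c d → (a - b) + (c - d) ≡ (a + c) - (b + d)
      eq = solve-∀

    ≡-mod-- : ∀ {a b c d} → a ≡ b [mod n ] → c ≡ d [mod n ] → a - c ≡ b - d [mod n ]
    ≡-mod-- {a} {b} {c} {d} (≡-mod p) (≡-mod q) = ≡-mod (subst (+ n ∣_) (eq a b c d) (∣m∣n⇒∣m-n p q))
      where
      eq : ∀ a b c d → (a - b) - (c - d) ≡ (a - c) - (b - d)
      eq = solve-∀

    ≡-mod-* : ∀ {a b c d} → a ≡ b [mod n ] → c ≡ d [mod n ] → a * c ≡ b * d [mod n ]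
    ≡-mod-* {a} {b} {c} {d} (≡-mod p) (≡-mod q) =
      ≡-mod (subst (+ n ∣_) (eq a b c d) (∣m∣n⇒∣m+n (∣m⇒∣m*n c p) (∣n⇒∣m*n b q)))
      where
      eq : ∀ a b c d → (a - b) * c + b * (c - d) ≡ a * c - b * d
      eq = solve-∀

    ≡-mod-neg : ∀ {a b} → a ≡ b [mod n ] → - a ≡ - b [mod n ]
    ≡-mod-neg {a} {b} (≡-mod p) = ≡-mod (subst (+ n ∣_) (eq a b) (∣m⇒∣-m p))
      where
      eq : ∀ a b → - (a - b) ≡ - a - - b
      eq = solve-∀

    ∣-resp-≡-mod : ∀ {a b} → a ≡ b [mod n ] → + n ∣ b → + n ∣ a
    ∣-resp-≡-mod {a} {b} (≡-mod p) q = subst (+ n ∣_) (eq a b) (∣m∣n⇒∣m+n p q)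
      where
      eq : ∀ a b → (a - b) + b ≡ a
      eq = solve-∀

  ≡-mod-weaken : ∀ {d n a b} → + d ∣ + n → a ≡ b [mod n ] → a ≡ b [mod d ]
  ≡-mod-weaken d∣n (≡-mod p) = ≡-mod (∣-trans d∣n p)

  ≡-mod-%ℕ : ∀ n .{{_ : ℕ.NonZero n}} a → a ≡ + (a %ℕ n) [mod n ]
  ≡-mod-%ℕ n a = ≡-mod (divides (a /ℕ n) (begin
    a - + (a %ℕ n)                           ≡⟨ cong (_- + (a %ℕ n)) (a≡a%ℕn+[a/ℕn]*n a n) ⟩
    + (a %ℕ n) + (a /ℕ n) * + n - + (a %ℕ n) ≡⟨ eq (+ (a %ℕ n)) ((a /ℕ n) * + n) ⟩
    (a /ℕ n) * + n                           ∎))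
    where
    open ≡-Reasoning
    eq : ∀ r s → r + s - r ≡ s
    eq = solve-∀

  record _≈_[mod_] (u v : Point) (n : ℕ) : Set where
    constructor ≈-mod
    field
      x-≡ : proj₁ u ≡ proj₁ v [mod n ]
      y-≡ : proj₁ (proj₂ u) ≡ proj₁ (proj₂ v) [mod n ]
      z-≡ : proj₂ (proj₂ u) ≡ proj₂ (proj₂ v) [mod n ]

  ≈-mod-sym : ∀ {n u v} → u ≈ v [mod n ] → v ≈ u [mod n ]
  ≈-mod-sym (≈-mod p q r) = ≈-mod (≡-mod-sym p) (≡-mod-sym q) (≡-mod-sym r)

  ≈-mod-trans : ∀ {n u v w} → u ≈ v [mod n ] → v ≈ w [mod n ] → u ≈ w [mod n ]
  ≈-mod-trans (≈-mod p q r) (≈-mod p′ q′ r′) = ≈-mod (≡-mod-trans p p′) (≡-mod-trans q q′) (≡-mod-trans r r′)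

  congruent-ops : (n : ℕ) → RingOps (Σ ℤ λ a → Σ ℤ λ b → a ≡ b [mod n ])
  congruent-ops n = record
    { _+_ = λ (a , b , p) (c , d , q) → a + c , b + d , ≡-mod-+ p q
    ; _-_ = λ (a , b , p) (c , d , q) → a - c , b - d , ≡-mod-- p q
    ; _*_ = λ (a , b , p) (c , d , q) → a * c , b * d , ≡-mod-* p q
    ; #_  = λ k → + k , + k , ≡-mod-refl
    }

  module Congruent n = Forms (congruent-ops n)

  pairUp : ∀ {n u v} → u ≈ v [mod n ] → Congruent.Point n
  pairUp {u = x , y , z} {x′ , y′ , z′} (≈-mod p q r) = (x , x′ , p) , (y , y′ , q) , (z , z′ , r)

  F-cong : ∀ {n u v} → u ≈ v [mod n ] → F u ≡ F v [mod n ]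
  F-cong {n} u≈v = proj₂ (proj₂ (Congruent.F n (pairUp u≈v)))

  G-cong : ∀ {n u v} → u ≈ v [mod n ] → G u ≡ G v [mod n ]
  G-cong {n} u≈v = proj₂ (proj₂ (Congruent.G n (pairUp u≈v)))

  ℓ-cong : ∀ {n u v} → u ≈ v [mod n ] → ℓ u ≡ ℓ v [mod n ]
  ℓ-cong {n} u≈v = proj₂ (proj₂ (Congruent.ℓ n (pairUp u≈v)))

  ⟨_,_,_⟩ : ∀ {n} → Fin n → Fin n → Fin n → Point
  ⟨ a , b , c ⟩ = + toℕ a , + toℕ b , + toℕ c

  residue : ∀ n .{{_ : ℕ.NonZero n}} → ℤ → Fin n
  residue n a = fromℕ< (n%ℕd<d a n)

  ≡-mod-residue : ∀ n .{{_ : ℕ.NonZero n}} a → a ≡ + toℕ (residue n a) [mod n ]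
  ≡-mod-residue n a rewrite toℕ-fromℕ< (n%ℕd<d a n) = ≡-mod-%ℕ n a

  by-residues : ∀ n .{{_ : ℕ.NonZero n}} (P : Pred Point 0ℓ) →
                (∀ {u v} → u ≈ v [mod n ] → P v → P u) →
                (∀ a b c → P ⟨ a , b , c ⟩) → ∀ v → P v
  by-residues n P P-resp P-residues (x , y , z) =
    P-resp (≈-mod (≡-mod-residue n x) (≡-mod-residue n y) (≡-mod-residue n z)) (P-residues _ _ _)

  infixl 7 _÷_

  -- The quotient is junk (zero) when k ∤ a.
  _÷_ : ℤ → ℤ → ℤ
  a ÷ k with k ∣? a
  ... | yes k∣a = _∣_.quotient k∣a
  ... | no _    = 0ℤ

  ÷-exact : ∀ {k a} → k ∣ a → a ≡ (a ÷ k) * k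
  ÷-exact {k} {a} k∣a with k ∣? a
  ... | yes k∣a′ = _∣_.equality k∣a′
  ... | no k∤a   = ⊥-elim (k∤a k∣a)

  *÷-cancel : ∀ q k .{{_ : ℤ.NonZero k}} → (q * k) ÷ k ≡ q
  *÷-cancel q k = ℤ.*-cancelʳ-≡ _ q k (sym (÷-exact (divides q refl)))

  -- Counting

  count : {A : Set} {P : Pred A 0ℓ} → Decidable P → List A → ℕ
  count P? = length ∘ filter P?

  indicator : {A : Set} → Dec A → ℕ
  indicator a? = if does a? then 1 else 0

  module _ {A : Set} {P : Pred A 0ℓ} (P? : Decidable P) where

    count-∷ : ∀ x xs → count P? (x ∷ xs) ≡ indicator (P? x) ℕ.+ count P? xs
    count-∷ x xs with does (P? x)
    ... | true  = refl
    ... | false = refl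

    count≡sum-indicator : ∀ xs → count P? xs ≡ sum (map (indicator ∘ P?) xs)
    count≡sum-indicator []       = refl
    count≡sum-indicator (x ∷ xs) = trans (count-∷ x xs) (cong (indicator (P? x) ℕ.+_) (count≡sum-indicator xs))

  sum-map-+ : {B : Set} (f g : B → ℕ) (bs : List B) →
              sum (map (λ b → f b ℕ.+ g b) bs) ≡ sum (map f bs) ℕ.+ sum (map g bs)
  sum-map-+ f g []       = refl
  sum-map-+ f g (b ∷ bs) = trans (cong (f b ℕ.+ g b ℕ.+_) (sum-map-+ f g bs)) (interchange (f b) (g b) _ _)
    where
    interchange : ∀ a b c d → a ℕ.+ b ℕ.+ (c ℕ.+ d) ≡ a ℕ.+ c ℕ.+ (b ℕ.+ d)
    interchange = ℕ-Solver.solve-∀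

  sum-map-0 : {B : Set} (bs : List B) → sum (map (λ _ → 0) bs) ≡ 0
  sum-map-0 []       = refl
  sum-map-0 (_ ∷ bs) = sum-map-0 bs

  module _ {A B : Set} {P : Pred A 0ℓ} {R : B → Pred A 0ℓ}
           (P? : Decidable P) (R? : ∀ b → Decidable (R b)) (k : ℕ) (bs : List B)
           (regular : ∀ x → P x → count (λ b → R? b x) bs ≡ k) where

    private
      row : ∀ x → sum (map (λ b → indicator (P? x ×-dec R? b x)) bs) ≡ k ℕ.* indicator (P? x)
      row x with P? x
      ... | yes Px = begin
        sum (map (λ b → indicator (R? b x)) bs) ≡⟨ count≡sum-indicator (λ b → R? b x) bs ⟨
        count (λ b → R? b x) bs                 ≡⟨ regular x Px ⟩
        k                                       ≡⟨ ℕ.*-identityʳ k ⟨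
        k ℕ.* 1                                 ∎
        where open ≡-Reasoning
      ... | no _ = trans (sum-map-0 bs) (sym (ℕ.*-zeroʳ k))

    sum-count-× : ∀ xs → sum (map (λ b → count (λ x → P? x ×-dec R? b x) xs) bs) ≡ k ℕ.* count P? xs
    sum-count-× [] = trans (sum-map-0 bs) (sym (ℕ.*-zeroʳ k))
    sum-count-× (x ∷ xs) = begin
      sum (map (λ b → count (λ x → P? x ×-dec R? b x) (x ∷ xs)) bs)
        ≡⟨ cong sum (map-cong (λ b → count-∷ (λ x → P? x ×-dec R? b x) x xs) bs) ⟩
      sum (map (λ b → indicator (P? x ×-dec R? b x) ℕ.+ count (λ x → P? x ×-dec R? b x) xs) bs)
        ≡⟨ sum-map-+ _ _ bs ⟩
      sum (map (λ b → indicator (P? x ×-dec R? b x)) bs) ℕ.+ sum (map (λ b → count (λ x → P? x ×-dec R? b x) xs) bs)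
        ≡⟨ cong₂ ℕ._+_ (row x) (sum-count-× xs) ⟩
      k ℕ.* indicator (P? x) ℕ.+ k ℕ.* count P? xs
        ≡⟨ ℕ.*-distribˡ-+ k _ _ ⟨
      k ℕ.* (indicator (P? x) ℕ.+ count P? xs)
        ≡⟨ cong (k ℕ.*_) (count-∷ P? x xs) ⟨
      k ℕ.* count P? (x ∷ xs) ∎
      where open ≡-Reasoning

  record InverseOn {A B : Set} (P : Pred A 0ℓ) (Q : Pred B 0ℓ) : Set where
    field
      to        : A → B
      from      : B → A
      to-resp   : ∀ {x} → P x → Q (to x)
      from-resp : ∀ {y} → Q y → P (from y)
      from∘to   : ∀ {x} → P x → from (to x) ≡ x
      to∘from   : ∀ {y} → Q y → to (from y) ≡ y

    flip : InverseOn Q P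
    flip = record
      { to = from ; from = to ; to-resp = from-resp ; from-resp = to-resp ; from∘to = to∘from ; to∘from = from∘to }

  module _ {A B : Set} where

    ∈-remove : ∀ {y z : B} us {vs} → y ≢ z → y ∈ us ++ z ∷ vs → y ∈ us ++ vs
    ∈-remove us y≢z y∈ with ∈-++⁻ us y∈
    ... | inj₁ y∈us         = ∈-++⁺ˡ y∈us
    ... | inj₂ (here y≡z)   = ⊥-elim (y≢z y≡z)
    ... | inj₂ (there y∈vs) = ∈-++⁺ʳ us y∈vs

    length-≤-injective : ∀ {xs : List A} {ys : List B} (f : A → B) → Unique xs →
                         (∀ {x} → x ∈ xs → f x ∈ ys) →
                         (∀ {x x′} → x ∈ xs → x′ ∈ xs → f x ≡ f x′ → x ≡ x′) →
                         length xs ℕ.≤ length ys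
    length-≤-injective {[]}     f _              _    _   = ℕ.z≤n
    length-≤-injective {x ∷ xs} f (x∉xs ∷ xs!) ∈ys inj with ∈-∃++ (∈ys (here refl))
    ... | us , vs , refl = begin
      ℕ.suc (length xs)         ≤⟨ ℕ.s≤s (length-≤-injective f xs! ∈us++vs (λ p q → inj (there p) (there q))) ⟩
      ℕ.suc (length (us ++ vs)) ≡⟨ cong ℕ.suc (length-++ us) ⟩
      ℕ.suc (length us ℕ.+ length vs) ≡⟨ ℕ.+-suc (length us) (length vs) ⟨
      length us ℕ.+ length (f x ∷ vs) ≡⟨ length-++ us ⟨
      length (us ++ f x ∷ vs) ∎
      where
      open ℕ.≤-Reasoning
      ∈us++vs : ∀ {x′} → x′ ∈ xs → f x′ ∈ us ++ vs
      ∈us++vs x′∈xs =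
        ∈-remove us (λ eq → All.lookup x∉xs x′∈xs (sym (inj (there x′∈xs) (here refl) eq))) (∈ys (there x′∈xs))

  module _ {A B : Set} {P : Pred A 0ℓ} {Q : Pred B 0ℓ} (P? : Decidable P) (Q? : Decidable Q) where

    count-≤ : ∀ {xs ys} → Unique xs → Q ⊆ (_∈ ys) → InverseOn P Q → count P? xs ℕ.≤ count Q? ys
    count-≤ {xs} {ys} xs! Q⊆ys inv = length-≤-injective to (Unique.filter⁺ P? xs!) to-∈ injective
      where
      open InverseOn inv
      to-∈ : ∀ {x} → x ∈ filter P? xs → to x ∈ filter Q? ys
      to-∈ x∈ = let Qy = to-resp (proj₂ (∈-filter⁻ P? {xs = xs} x∈)) in ∈-filter⁺ Q? (Q⊆ys Qy) Qy
      injective : ∀ {x x′} → x ∈ filter P? xs → x′ ∈ filter P? xs → to x ≡ to x′ → x ≡ x′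
      injective x∈ x′∈ eq = begin
        _           ≡⟨ from∘to (proj₂ (∈-filter⁻ P? {xs = xs} x∈)) ⟨
        from (to _) ≡⟨ cong from eq ⟩
        from (to _) ≡⟨ from∘to (proj₂ (∈-filter⁻ P? {xs = xs} x′∈)) ⟩
        _           ∎
        where open ≡-Reasoning

  count-≡ : {A B : Set} {P : Pred A 0ℓ} {Q : Pred B 0ℓ} (P? : Decidable P) (Q? : Decidable Q) →
            ∀ {xs ys} → Unique xs → Unique ys → P ⊆ (_∈ xs) → Q ⊆ (_∈ ys) →
            InverseOn P Q → count P? xs ≡ count Q? ys
  count-≡ P? Q? xs! ys! P⊆xs Q⊆ys inv =
    ℕ.≤-antisym (count-≤ P? Q? xs! Q⊆ys inv) (count-≤ Q? P? ys! P⊆xs (InverseOn.flip inv))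

  -- The box [-M, M]³ searched by reps

  box : ℕ → List Point
  box M = concatMap (λ x → concatMap (λ y → map (λ z → x , y , z) (range M)) (range M)) (range M)

  concatMap-unique : {A B : Set} {f : A → List B} (key : B → A) → (∀ {x y} → y ∈ f x → key y ≡ x) →
                     ∀ {xs} → Unique xs → (∀ x → Unique (f x)) → Unique (concatMap f xs)
  concatMap-unique key key-∈ {[]}     _            _  = []
  concatMap-unique {f = f} key key-∈ {x ∷ xs} (x∉xs ∷ xs!) f! =
    Unique.++⁺ (f! x) (concatMap-unique key key-∈ xs! f!) disjoint
    where
    disjoint : Disjoint (f x) (concatMap f xs)
    disjoint (y∈fx , y∈rest) with ∈-concat⁻′ (map f xs) y∈rest
    ... | _ , y∈fx′ , fx′∈ with ∈-map⁻ f fx′∈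
    ... | x′ , x′∈xs , refl = All.lookup x∉xs x′∈xs (trans (sym (key-∈ y∈fx)) (key-∈ y∈fx′))

  range-unique : ∀ M → Unique (range M)
  range-unique M = Unique.map⁺ injective (Unique.upTo⁺ _)
    where
    shift : ∀ a m → a - m + m ≡ a
    shift = solve-∀
    injective : ∀ {i j} → + i - + M ≡ + j - + M → i ≡ j
    injective e = ℤ.+-injective (trans (sym (shift _ (+ M))) (trans (cong (_+ + M) e) (shift _ (+ M))))

  box-unique : ∀ M → Unique (box M)
  box-unique M = concatMap-unique proj₁ x-key (range-unique M) λ x →
    concatMap-unique (proj₁ ∘ proj₂) y-key (range-unique M) λ y →
    Unique.map⁺ (cong (proj₂ ∘ proj₂)) (range-unique M)
    where
    y-key : ∀ {x y : ℤ} {v : Point} → v ∈ map (λ z → x , y , z) (range M) → proj₁ (proj₂ v) ≡ y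
    y-key v∈ with ∈-map⁻ _ v∈
    ... | _ , _ , refl = refl
    x-key : ∀ {x : ℤ} {v : Point} → v ∈ concatMap (λ y → map (λ z → x , y , z) (range M)) (range M) → proj₁ v ≡ x
    x-key v∈ with ∈-concat⁻′ (map _ (range M)) v∈
    ... | _ , v∈ys , ys∈ with ∈-map⁻ _ ys∈
    ... | _ , _ , refl with ∈-map⁻ _ v∈ys
    ... | _ , _ , refl = refl

  ∈-range : ∀ {M x} → - + M ≤ x → x ≤ + M → x ∈ range M
  ∈-range {M} {x} -M≤x x≤M = subst (_∈ range M) i-M≡x (∈-map⁺ _ (∈-upTo⁺ i<2M+1))
    where
    i : ℕ
    i = ℤ.∣ x + + M ∣
    +i≡x+M : + i ≡ x + + M
    +i≡x+M = ℤ.0≤i⇒+∣i∣≡i (subst (_≤ x + + M) (ℤ.+-inverseˡ (+ M)) (ℤ.+-monoˡ-≤ (+ M) -M≤x))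
    i-M≡x : + i - + M ≡ x
    i-M≡x = trans (cong (_- + M) +i≡x+M) (ring x (+ M))
      where
      ring : ∀ a m → a + m - m ≡ a
      ring = solve-∀
    i<2M+1 : i ℕ.< 2 ℕ.* M ℕ.+ 1
    i<2M+1 = ℕ.≤-trans (ℕ.s≤s i≤M+M) (ℕ.≤-reflexive (ring M))
      where
      i≤M+M : i ℕ.≤ M ℕ.+ M
      i≤M+M = ℤ.drop‿+≤+ (subst₂ _≤_ (sym +i≡x+M) (ℤ.pos-+ M M) (ℤ.+-monoˡ-≤ (+ M) x≤M))
      ring : ∀ M → ℕ.suc (M ℕ.+ M) ≡ 2 ℕ.* M ℕ.+ 1
      ring = ℕ-Solver.solve-∀

  ∈-box : ∀ {M x y z} → - + M ≤ x × x ≤ + M → - + M ≤ y × y ≤ + M → - + M ≤ z × z ≤ + M → (x , y , z) ∈ box M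
  ∈-box (x₁ , x₂) (y₁ , y₂) (z₁ , z₂) =
    ∈-concat⁺′ (∈-concat⁺′ (∈-map⁺ _ (∈-range z₁ z₂)) (∈-map⁺ _ (∈-range y₁ y₂))) (∈-map⁺ _ (∈-range x₁ x₂))

  square-nonNeg : ∀ x → 0ℤ ≤ x * x
  square-nonNeg (+ n)    = subst (0ℤ ≤_) (ℤ.pos-* n n) (+≤+ ℕ.z≤n)
  square-nonNeg -[1+ n ] = +≤+ ℕ.z≤n

  scaled-square-nonNeg : ∀ a x → 0ℤ ≤ + a * (x * x)
  scaled-square-nonNeg a x = subst (_≤ + a * (x * x)) (ℤ.*-zeroʳ (+ a)) (ℤ.*-monoˡ-≤-nonNeg (+ a) (square-nonNeg x))

  square-bound : ∀ {M} x → x * x ≤ + M → - + M ≤ x × x ≤ + M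
  square-bound (+ n) n²≤M =
    ℤ.neg-≤-pos , +≤+ (ℕ.≤-trans (n≤n*n n) (ℤ.drop‿+≤+ (subst (_≤ _) (sym (ℤ.pos-* n n)) n²≤M)))
    where
    n≤n*n : ∀ n → n ℕ.≤ n ℕ.* n
    n≤n*n ℕ.zero    = ℕ.z≤n
    n≤n*n (ℕ.suc n) = ℕ.m≤m*n (ℕ.suc n) (ℕ.suc n)
  square-bound -[1+ n ] n²≤M = ℤ.neg-mono-≤ (+≤+ (ℕ.≤-trans (ℕ.m≤m*n (ℕ.suc n) (ℕ.suc n)) (ℤ.drop‿+≤+ n²≤M))) , -≤+

  ≤-by-nonNeg-excess : ∀ {a b s} → a ≡ b + s → 0ℤ ≤ s → b ≤ a
  ≤-by-nonNeg-excess {a} {b} a≡b+s 0≤s =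
    subst₂ _≤_ (ℤ.+-identityʳ b) (sym a≡b+s) (ℤ.+-monoʳ-≤ b 0≤s)

  coordinate²≤norm² : ∀ x y z → x * x ≤ norm² (x , y , z) × y * y ≤ norm² (x , y , z) × z * z ≤ norm² (x , y , z)
  coordinate²≤norm² x y z =
    ≤-by-nonNeg-excess (split-x x y z) (ℤ.+-mono-≤ (square-nonNeg y) (square-nonNeg z)) ,
    ≤-by-nonNeg-excess (split-y x y z) (ℤ.+-mono-≤ (square-nonNeg x) (square-nonNeg z)) ,
    ≤-by-nonNeg-excess (split-z x y z) (ℤ.+-mono-≤ (square-nonNeg x) (square-nonNeg y))
    where
    split-x : ∀ x y z → x * x + y * y + z * z ≡ x * x + (y * y + z * z)
    split-x = solve-∀
    split-y : ∀ x y z → x * x + y * y + z * z ≡ y * y + (x * x + z * z)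
    split-y = solve-∀
    split-z : ∀ x y z → x * x + y * y + z * z ≡ z * z + (x * x + y * y)
    split-z = solve-∀

  norm²-bound-∈-box : ∀ {M} v → norm² v ≤ + M → v ∈ box M
  norm²-bound-∈-box (x , y , z) v≤M with coordinate²≤norm² x y z
  ... | x²≤ , y²≤ , z²≤ = ∈-box (square-bound x (ℤ.≤-trans x²≤ v≤M))
                                (square-bound y (ℤ.≤-trans y²≤ v≤M))
                                (square-bound z (ℤ.≤-trans z²≤ v≤M))

  norm²≤F : ∀ v → norm² v ≤ F v
  norm²≤F (x , y , z) =
    ≤-by-nonNeg-excess (split x y z) (ℤ.+-mono-≤ (scaled-square-nonNeg 7 y) (scaled-square-nonNeg 7 z))
    where
    split : ∀ x y z → F (x , y , z) ≡ norm² (x , y , z) + (+ 7 * (y * y) + + 7 * (z * z))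
    split = solve 3 (λ x y z → Syntax.F (x , y , z) :=
                                Syntax.norm² (x , y , z) :+ (con (+ 7) :* (y :* y) :+ con (+ 7) :* (z :* z))) refl

  norm²≤G : ∀ v → norm² v ≤ G v
  norm²≤G (x , y , z) =
    ≤-by-nonNeg-excess (split x y z)
      (ℤ.+-mono-≤ (ℤ.+-mono-≤ (ℤ.+-mono-≤ (square-nonNeg (x + y)) (square-nonNeg x)) (scaled-square-nonNeg 3 y))
                  (scaled-square-nonNeg 13 z))
    where
    split : ∀ x y z → G (x , y , z) ≡ norm² (x , y , z) + ((x + y) * (x + y) + x * x + + 3 * (y * y) + + 13 * (z * z))
    split = solve 3 (λ x y z → Syntax.G (x , y , z) :=
                                Syntax.norm² (x , y , z) :+
                                ((x :+ y) :* (x :+ y) :+ x :* x :+ con (+ 3) :* (y :* y) :+ con (+ 13) :* (z :* z))) refl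

  F-solution-∈-box : ∀ {M v} → F v ≡ + M → v ∈ box M
  F-solution-∈-box {v = v} Fv≡M = norm²-bound-∈-box v (subst (norm² v ≤_) Fv≡M (norm²≤F v))

  G-solution-∈-box : ∀ {M v} → G v ≡ + M → v ∈ box M
  G-solution-∈-box {v = v} Gv≡M = norm²-bound-∈-box v (subst (norm² v ≤_) Gv≡M (norm²≤G v))

  -- Signed permutations of (y, z)

  negateY negateZ swapYZ : Point → Point
  negateY (x , y , z) = x , - y , z
  negateZ (x , y , z) = x , y , - z
  swapYZ  (x , y , z) = x , z , y

  when : Bool → (Point → Point) → Point → Point
  when b f = if b then f else id

  when-preserves : (P : (Point → Point) → Set) → P id → ∀ {f} → P f → ∀ b → P (when b f)
  when-preserves P P-id P-f false = P-id
  when-preserves P P-id P-f true  = P-f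

  Symmetry : Set
  Symmetry = Bool × Bool × Bool

  symmetries : List Symmetry
  symmetries = cartesianProduct bools (cartesianProduct bools bools)
    where
    bools = false ∷ true ∷ []

  symmetry symmetry⁻¹ : Symmetry → Point → Point
  symmetry   (b , c , s) = when b negateY ∘ when c negateZ ∘ when s swapYZ
  symmetry⁻¹ (b , c , s) = when s swapYZ ∘ when c negateZ ∘ when b negateY

  negateY-involutive : Involutive _≡_ negateY
  negateY-involutive (x , y , z) = cong (λ t → x , t , z) (ℤ.neg-involutive y)

  negateZ-involutive : Involutive _≡_ negateZ
  negateZ-involutive (x , y , z) = cong (λ t → x , y , t) (ℤ.neg-involutive z)

  swapYZ-involutive : Involutive _≡_ swapYZ
  swapYZ-involutive _ = refl

  when-involutive : ∀ {f} → Involutive _≡_ f → ∀ b → Involutive _≡_ (when b f)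
  when-involutive = when-preserves (Involutive _≡_) (λ _ → refl)

  module _ (σ : Symmetry) where
    private
      b = proj₁ σ
      c = proj₁ (proj₂ σ)
      s = proj₂ (proj₂ σ)
      b-involutive = when-involutive {negateY} negateY-involutive b
      c-involutive = when-involutive {negateZ} negateZ-involutive c
      s-involutive = when-involutive {swapYZ} swapYZ-involutive s

    symmetry⁻¹∘symmetry : ∀ v → symmetry⁻¹ σ (symmetry σ v) ≡ v
    symmetry⁻¹∘symmetry v = begin
      when s swapYZ (when c negateZ (when b negateY (when b negateY (when c negateZ (when s swapYZ v)))))
        ≡⟨ cong (when s swapYZ ∘ when c negateZ) (b-involutive _) ⟩
      when s swapYZ (when c negateZ (when c negateZ (when s swapYZ v)))
        ≡⟨ cong (when s swapYZ) (c-involutive _) ⟩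
      when s swapYZ (when s swapYZ v)
        ≡⟨ s-involutive v ⟩
      v ∎
      where open ≡-Reasoning

    symmetry∘symmetry⁻¹ : ∀ v → symmetry σ (symmetry⁻¹ σ v) ≡ v
    symmetry∘symmetry⁻¹ v = begin
      when b negateY (when c negateZ (when s swapYZ (when s swapYZ (when c negateZ (when b negateY v)))))
        ≡⟨ cong (when b negateY ∘ when c negateZ) (s-involutive _) ⟩
      when b negateY (when c negateZ (when c negateZ (when b negateY v)))
        ≡⟨ cong (when b negateY) (c-involutive _) ⟩
      when b negateY (when b negateY v)
        ≡⟨ b-involutive v ⟩
      v ∎
      where open ≡-Reasoning

  Isometry : (Point → Point) → Set
  Isometry f = ∀ v → F (f v) ≡ F v

  ∘-isometry : ∀ {f g} → Isometry f → Isometry g → Isometry (f ∘ g)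
  ∘-isometry f-iso g-iso v = trans (f-iso _) (g-iso v)

  negateY-isometry : Isometry negateY
  negateY-isometry (x , y , z) = solve 3 (λ x y z → Syntax.F (x , :- y , z) := Syntax.F (x , y , z)) refl x y z

  negateZ-isometry : Isometry negateZ
  negateZ-isometry (x , y , z) = solve 3 (λ x y z → Syntax.F (x , y , :- z) := Syntax.F (x , y , z)) refl x y z

  swapYZ-isometry : Isometry swapYZ
  swapYZ-isometry (x , y , z) = solve 3 (λ x y z → Syntax.F (x , z , y) := Syntax.F (x , y , z)) refl x y z

  when-isometry : ∀ {f} → Isometry f → ∀ b → Isometry (when b f)
  when-isometry = when-preserves Isometry (λ _ → refl)

  symmetry-isometry : ∀ σ → Isometry (symmetry σ)
  symmetry-isometry (b , c , s) =
    ∘-isometry {when b negateY} (when-isometry negateY-isometry b)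
      (∘-isometry {when c negateZ} (when-isometry negateZ-isometry c) (when-isometry {swapYZ} swapYZ-isometry s))

  symmetry⁻¹-isometry : ∀ σ → Isometry (symmetry⁻¹ σ)
  symmetry⁻¹-isometry (b , c , s) =
    ∘-isometry {when s swapYZ} (when-isometry {swapYZ} swapYZ-isometry s)
      (∘-isometry {when c negateZ} (when-isometry negateZ-isometry c) (when-isometry negateY-isometry b))

  PreservesCongruence : (Point → Point) → Set
  PreservesCongruence f = ∀ {n u v} → u ≈ v [mod n ] → f u ≈ f v [mod n ]

  when-preservesCongruence : ∀ {f} → PreservesCongruence f → ∀ b → PreservesCongruence (when b f)
  when-preservesCongruence = when-preserves PreservesCongruence id

  symmetry-preservesCongruence : ∀ σ → PreservesCongruence (symmetry σ)
  symmetry-preservesCongruence (b , c , s) u≈v =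
    when-preservesCongruence {negateY} (λ (≈-mod p q r) → ≈-mod p (≡-mod-neg q) r) b
      (when-preservesCongruence {negateZ} (λ (≈-mod p q r) → ≈-mod p q (≡-mod-neg r)) c
        (when-preservesCongruence {swapYZ} (λ (≈-mod p q r) → ≈-mod p r q) s u≈v))

  -- The sublattices Λ₇ and Λ₄

  Λ₇ : Pred Point 0ℓ
  Λ₇ v = + 7 ∣ ℓ v

  Λ₇? : Decidable Λ₇
  Λ₇? v = + 7 ∣? ℓ v

  Λ₄ : Pred Point 0ℓ
  Λ₄ (w₁ , w₂ , w₃) = + 2 ∣ w₂ × + 2 ∣ w₁ + w₂ + w₃

  Λ₄? : Decidable Λ₄
  Λ₄? (w₁ , w₂ , w₃) = + 2 ∣? w₂ ×-dec + 2 ∣? w₁ + w₂ + w₃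

  Λ₇-resp-≈ : ∀ {u v} → u ≈ v [mod 7 ] → Λ₇ v → Λ₇ u
  Λ₇-resp-≈ u≈v = ∣-resp-≡-mod (ℓ-cong u≈v)

  Λ₄-resp-≈ : ∀ {u v} → u ≈ v [mod 8 ] → Λ₄ v → Λ₄ u
  Λ₄-resp-≈ (≈-mod p q r) (2∣v₂ , 2∣Σv) =
    ∣-resp-≡-mod (mod2 q) 2∣v₂ , ∣-resp-≡-mod (≡-mod-+ (≡-mod-+ (mod2 p) (mod2 q)) (mod2 r)) 2∣Σv
    where
    mod2 : ∀ {a b} → a ≡ b [mod 8 ] → a ≡ b [mod 2 ]
    mod2 = ≡-mod-weaken (divides (+ 4) refl)

  Λ₇-images : Point → ℕ
  Λ₇-images v = count (λ σ → Λ₇? (symmetry σ v)) symmetries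

  Λ₇-images-cong : ∀ {u v} → u ≈ v [mod 7 ] → Λ₇-images u ≡ Λ₇-images v
  Λ₇-images-cong {u} {v} u≈v = cong length (filter-≐ (λ σ → Λ₇? (symmetry σ u)) (λ σ → Λ₇? (symmetry σ v))
    ((λ {σ} → Λ₇-resp-≈ (symmetry-preservesCongruence σ (≈-mod-sym u≈v))) ,
     (λ {σ} → Λ₇-resp-≈ (symmetry-preservesCongruence σ u≈v)))
    symmetries)

  -- Finite checks over residues

  infix 4 _≡?_[mod_] _≈?_[mod_]

  _≡?_[mod_] : ∀ a b n → Dec (a ≡ b [mod n ])
  a ≡? b [mod n ] = map′ ≡-mod ∣-diff (+ n ∣? a - b)

  _≈?_[mod_] : ∀ u v n → Dec (u ≈ v [mod n ])
  (x , y , z) ≈? (x′ , y′ , z′) [mod n ] =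
    map′ (λ (p , q , r) → ≈-mod p q r) (λ (≈-mod p q r) → p , q , r)
         ((x ≡? x′ [mod n ]) ×-dec (y ≡? y′ [mod n ]) ×-dec (z ≡? z′ [mod n ]))

  NonResidue₇ : ℕ → Set
  NonResidue₇ m = m ≢ 0 × ¬ (∃ λ (x : Fin 7) → toℕ x ℕ.* toℕ x ℕ.% 7 ≡ m)

  nonResidue₇? : ∀ m → Dec (NonResidue₇ m)
  nonResidue₇? m = ¬? (m ℕ.≟ 0) ×-dec ¬? (any? λ x → toℕ x ℕ.* toℕ x ℕ.% 7 ℕ.≟ m)

  origin : Point
  origin = 0ℤ , 0ℤ , 0ℤ

  Λ₇-images-nonresidue-residues : ∀ (m a b c : Fin 7) → NonResidue₇ (toℕ m) →
                                  F ⟨ a , b , c ⟩ ≡ + toℕ m [mod 7 ] → Λ₇-images ⟨ a , b , c ⟩ ≡ 2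
  Λ₇-images-nonresidue-residues = toWitness {a? = all? λ m → all? λ a → all? λ b → all? λ c →
    nonResidue₇? (toℕ m) →-dec F ⟨ a , b , c ⟩ ≡? + toℕ m [mod 7 ] →-dec Λ₇-images ⟨ a , b , c ⟩ ℕ.≟ 2} _

  Λ₇-images-multiple-residues : ∀ (a b c : Fin 7) → F ⟨ a , b , c ⟩ ≡ 0ℤ [mod 7 ] →
                                ⟨ a , b , c ⟩ ≈ origin [mod 7 ] ⊎ Λ₇-images ⟨ a , b , c ⟩ ≡ 1
  Λ₇-images-multiple-residues = toWitness {a? = all? λ a → all? λ b → all? λ c →
    F ⟨ a , b , c ⟩ ≡? 0ℤ [mod 7 ] →-dec (⟨ a , b , c ⟩ ≈? origin [mod 7 ] ⊎-dec Λ₇-images ⟨ a , b , c ⟩ ℕ.≟ 1)} _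

  Λ₄-residues : ∀ (a b c : Fin 8) → G ⟨ a , b , c ⟩ ≡ + 1 [mod 8 ] → Λ₄ ⟨ a , b , c ⟩
  Λ₄-residues = toWitness {a? = all? λ a → all? λ b → all? λ c →
    G ⟨ a , b , c ⟩ ≡? + 1 [mod 8 ] →-dec Λ₄? ⟨ a , b , c ⟩} _

  ≡-mod-0⇒∣ : ∀ {n a} → a ≡ 0ℤ [mod n ] → + n ∣ a
  ≡-mod-0⇒∣ a≡0 = ∣-resp-≡-mod a≡0 (divides 0ℤ refl)

  49∣F-of-multiple-of-7 : ∀ {v} → v ≈ origin [mod 7 ] → + 49 ∣ F v
  49∣F-of-multiple-of-7 {x , y , z} (≈-mod p q r) with ≡-mod-0⇒∣ p | ≡-mod-0⇒∣ q | ≡-mod-0⇒∣ r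
  ... | divides a refl | divides b refl | divides c refl = divides (F (a , b , c)) (scale a b c)
    where
    scale : ∀ a b c → F (a * + 7 , b * + 7 , c * + 7) ≡ F (a , b , c) * + 49
    scale = solve 3 (λ a b c → Syntax.F (a :* con (+ 7) , b :* con (+ 7) , c :* con (+ 7)) :=
                               Syntax.F (a , b , c) :* con (+ 49)) refl

  module _ {M : ℕ} where

    Λ₇-images-nonresidue : LegendreMinus1mod7 M → ∀ v → F v ≡ + M → Λ₇-images v ≡ 2
    Λ₇-images-nonresidue (7∤M , M-nonsquare) v Fv≡M =
      by-residues 7 P P-resp (λ a b c → Λ₇-images-nonresidue-residues m a b c m-nonresidue) v
        (subst (_≡ + toℕ m [mod 7 ]) (sym Fv≡M) (≡-mod-residue 7 (+ M)))
      where
      m = residue 7 (+ M)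
      P : Pred Point 0ℓ
      P v = F v ≡ + toℕ m [mod 7 ] → Λ₇-images v ≡ 2
      P-resp : ∀ {u v} → u ≈ v [mod 7 ] → P v → P u
      P-resp u≈v Pv Fu≡m = trans (Λ₇-images-cong u≈v) (Pv (≡-mod-trans (≡-mod-sym (F-cong u≈v)) Fu≡m))
      m-nonresidue : NonResidue₇ (toℕ m)
      m-nonresidue rewrite toℕ-fromℕ< (n%ℕd<d (+ M) 7) = 7∤M , λ (x , x²≡M) → M-nonsquare (toℕ x , x²≡M)

    Λ₇-images-sevenExactly : SevenExactly M → ∀ v → F v ≡ + M → Λ₇-images v ≡ 1
    Λ₇-images-sevenExactly (7∣M , 49∤M) v Fv≡M =
      [ (λ v≈0 → ⊥-elim (49∤M (∣⇒∣ᵤ (subst (+ 49 ∣_) Fv≡M (49∣F-of-multiple-of-7 v≈0))))) , id ]′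
      (by-residues 7 P P-resp Λ₇-images-multiple-residues v F≡0)
      where
      P : Pred Point 0ℓ
      P v = F v ≡ 0ℤ [mod 7 ] → v ≈ origin [mod 7 ] ⊎ Λ₇-images v ≡ 1
      P-resp : ∀ {u v} → u ≈ v [mod 7 ] → P v → P u
      P-resp u≈v Pv Fu≡0 = Sum.map (≈-mod-trans u≈v) (trans (Λ₇-images-cong u≈v))
                                          (Pv (≡-mod-trans (≡-mod-sym (F-cong u≈v)) Fu≡0))
      F≡0 : F v ≡ 0ℤ [mod 7 ]
      F≡0 = ≡-mod (subst (+ 7 ∣_) (sym (trans (cong (_- 0ℤ) Fv≡M) (ℤ.+-identityʳ (+ M)))) (∣ᵤ⇒∣ 7∣M))

    Λ₄-solutions : M ℕ.% 8 ≡ 1 → ∀ w → G w ≡ + M → Λ₄ w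
    Λ₄-solutions M≡1 w Gw≡M = by-residues 8 P P-resp Λ₄-residues w
      (subst₂ (_≡_[mod 8 ]) (sym Gw≡M) (cong +_ (trans (toℕ-fromℕ< _) M≡1)) (≡-mod-residue 8 (+ M)))
      where
      P : Pred Point 0ℓ
      P w = G w ≡ + 1 [mod 8 ] → Λ₄ w
      P-resp : ∀ {u v} → u ≈ v [mod 8 ] → P v → P u
      P-resp u≈v Pv Gu≡1 = Λ₄-resp-≈ u≈v (Pv (≡-mod-trans (≡-mod-sym (G-cong u≈v)) Gu≡1))

  -- The correspondence between Λ₇ and Λ₄

  ℓ∘plane : ∀ k y z → ℓ (plane (k , y , z)) ≡ k * + 7
  ℓ∘plane = solve 3 (λ k y z → Syntax.ℓ (Syntax.plane (k , y , z)) := k :* con (+ 7)) refl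

  lattice-sum : ∀ w h g → w + + 2 * h + (+ 2 * g - w - + 2 * h) ≡ g * + 2
  lattice-sum = solve-∀

  G∘lattice∘α : ∀ t → G (lattice (α t)) ≡ F (plane t)
  G∘lattice∘α (k , y , z) =
    solve 3 (λ k y z → Syntax.G (Syntax.lattice (Syntax.α (k , y , z))) := Syntax.F (Syntax.plane (k , y , z))) refl k y z

  α∘β : ∀ s → α (β s) ≡ s
  α∘β (w , h , g) = cong₂ _,_ (first w h g) (cong (_, g) (second w h g))
    where
    first : ∀ w h g → + 3 * (g - h) - (+ 2 * g - w - + 3 * h) - g ≡ w
    first = solve-∀
    second : ∀ w h g → g - (g - h) ≡ h
    second = solve-∀

  β∘α : ∀ t → β (α t) ≡ t
  β∘α (k , y , z) = cong₂ _,_ (first k y z) (cong (_, z) (second k y z))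
    where
    first : ∀ k y z → z - (z - k) ≡ k
    first = solve-∀
    second : ∀ k y z → + 2 * z - (+ 3 * k - y - z) - + 3 * (z - k) ≡ y
    second = solve-∀

  Λ₇-plane : ∀ t → Λ₇ (plane t)
  Λ₇-plane (k , y , z) = divides k (ℓ∘plane k y z)

  planeCoords latticeCoords : Point → Point
  planeCoords (x , y , z) = ℓ (x , y , z) ÷ + 7 , y , z
  latticeCoords (w₁ , w₂ , w₃) = w₁ , w₂ ÷ + 2 , (w₁ + w₂ + w₃) ÷ + 2

  planeCoords∘plane : ∀ t → planeCoords (plane t) ≡ t
  planeCoords∘plane (k , y , z) = cong (_, y , z) (trans (cong (_÷ + 7) (ℓ∘plane k y z)) (*÷-cancel k (+ 7)))

  latticeCoords∘lattice : ∀ s → latticeCoords (lattice s) ≡ s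
  latticeCoords∘lattice (w , h , g) = cong (w ,_) (cong₂ _,_
    (trans (cong (_÷ + 2) (ℤ.*-comm (+ 2) h)) (*÷-cancel h (+ 2)))
    (trans (cong (_÷ + 2) (lattice-sum w h g)) (*÷-cancel g (+ 2))))

  plane∘planeCoords : ∀ v → Λ₇ v → plane (planeCoords v) ≡ v
  plane∘planeCoords (x , y , z) 7∣ℓv = cong (_, y , z) (begin
    + 7 * q - + 3 * y - + 5 * z            ≡⟨ recover q x y z ⟩
    x + (q * + 7 - ℓ (x , y , z))          ≡⟨ cong (λ t → x + (t - ℓ (x , y , z))) (÷-exact 7∣ℓv) ⟨
    x + (ℓ (x , y , z) - ℓ (x , y , z))    ≡⟨ cong (λ t → x + t) (ℤ.+-inverseʳ (ℓ (x , y , z))) ⟩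
    x + 0ℤ                                 ≡⟨ ℤ.+-identityʳ x ⟩
    x                                      ∎)
    where
    open ≡-Reasoning
    q = ℓ (x , y , z) ÷ + 7
    recover : ∀ q x y z → + 7 * q - + 3 * y - + 5 * z ≡ x + (q * + 7 - ℓ (x , y , z))
    recover = solve 4 (λ q x y z → con (+ 7) :* q :- con (+ 3) :* y :- con (+ 5) :* z :=
                                   x :+ (q :* con (+ 7) :- Syntax.ℓ (x , y , z))) refl

  lattice∘latticeCoords : ∀ w → Λ₄ w → lattice (latticeCoords w) ≡ w
  lattice∘latticeCoords (w₁ , w₂ , w₃) (2∣w₂ , 2∣Σw) = cong (w₁ ,_) (cong₂ _,_ second (begin
    + 2 * g - w₁ - + 2 * h ≡⟨ cong₂ (λ s t → s - w₁ - t) (trans (ℤ.*-comm (+ 2) g) (sym (÷-exact 2∣Σw))) second ⟩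
    w₁ + w₂ + w₃ - w₁ - w₂ ≡⟨ recover w₁ w₂ w₃ ⟩
    w₃                     ∎))
    where
    open ≡-Reasoning
    h = w₂ ÷ + 2
    g = (w₁ + w₂ + w₃) ÷ + 2
    second : + 2 * h ≡ w₂
    second = trans (ℤ.*-comm (+ 2) h) (sym (÷-exact 2∣w₂))
    recover : ∀ a b c → a + b + c - a - b ≡ c
    recover = solve-∀

  φ ψ : Point → Point
  φ = lattice ∘ α ∘ planeCoords
  ψ = plane ∘ β ∘ latticeCoords

  module _ {M : ℕ} (M≡1 : M ℕ.% 8 ≡ 1) where

    φ-ψ-inverse : InverseOn (λ v → F v ≡ + M × Λ₇ v) (λ w → G w ≡ + M)
    φ-ψ-inverse = record
      { to        = φ
      ; from      = ψ
      ; to-resp   = λ {v} (Fv≡M , 7∣ℓv) → begin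
          G (lattice (α (planeCoords v))) ≡⟨ G∘lattice∘α (planeCoords v) ⟩
          F (plane (planeCoords v))       ≡⟨ cong F (plane∘planeCoords v 7∣ℓv) ⟩
          F v                             ≡⟨ Fv≡M ⟩
          + M                             ∎
      ; from-resp = λ {w} Gw≡M → (begin
          F (plane (β (latticeCoords w)))         ≡⟨ G∘lattice∘α (β (latticeCoords w)) ⟨
          G (lattice (α (β (latticeCoords w))))   ≡⟨ cong (G ∘ lattice) (α∘β (latticeCoords w)) ⟩
          G (lattice (latticeCoords w))           ≡⟨ cong G (lattice∘latticeCoords w (Λ₄-solutions M≡1 w Gw≡M)) ⟩
          G w                                     ≡⟨ Gw≡M ⟩
          + M                                     ∎) , Λ₇-plane (β (latticeCoords w))
      ; from∘to   = λ {v} (_ , 7∣ℓv) → begin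
          plane (β (latticeCoords (lattice (α (planeCoords v)))))
            ≡⟨ cong (plane ∘ β) (latticeCoords∘lattice (α (planeCoords v))) ⟩
          plane (β (α (planeCoords v)))
            ≡⟨ cong plane (β∘α (planeCoords v)) ⟩
          plane (planeCoords v)
            ≡⟨ plane∘planeCoords v 7∣ℓv ⟩
          v ∎
      ; to∘from   = λ {w} Gw≡M → begin
          lattice (α (planeCoords (plane (β (latticeCoords w)))))
            ≡⟨ cong (lattice ∘ α) (planeCoords∘plane (β (latticeCoords w))) ⟩
          lattice (α (β (latticeCoords w)))
            ≡⟨ cong lattice (α∘β (latticeCoords w)) ⟩
          lattice (latticeCoords w)
            ≡⟨ lattice∘latticeCoords w (Λ₄-solutions M≡1 w Gw≡M) ⟩
          w ∎
      }
      where open ≡-Reasoning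

  -- For F and G this unfolds to reps with their coefficients.
  r : (Point → ℤ) → ℕ → ℕ
  r Q M = count (λ v → Q v ℤ.≟ + M) (box M)

  module _ (M : ℕ) where
    private
      F≡M? : Decidable (λ v → F v ≡ + M)
      F≡M? v = F v ℤ.≟ + M

      solutions-with-image-in-Λ₇? : (f : Point → Point) → Decidable (λ v → F v ≡ + M × Λ₇ (f v))
      solutions-with-image-in-Λ₇? f v = F≡M? v ×-dec Λ₇? (f v)

      F-solutions-∈-box : (f : Point → Point) → (λ v → F v ≡ + M × Λ₇ (f v)) ⊆ (_∈ box M)
      F-solutions-∈-box f (Fv≡M , _) = F-solution-∈-box Fv≡M

    count-symmetry : ∀ σ → count (solutions-with-image-in-Λ₇? (symmetry σ)) (box M) ≡
                           count (solutions-with-image-in-Λ₇? id) (box M)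
    count-symmetry σ = count-≡ (solutions-with-image-in-Λ₇? (symmetry σ)) (solutions-with-image-in-Λ₇? id)
      (box-unique M) (box-unique M) (F-solutions-∈-box (symmetry σ)) (F-solutions-∈-box id) record
      { to        = symmetry σ
      ; from      = symmetry⁻¹ σ
      ; to-resp   = λ {v} (Fv≡M , Λσv) → trans (symmetry-isometry σ v) Fv≡M , Λσv
      ; from-resp = λ {w} (Fw≡M , Λw) →
          trans (symmetry⁻¹-isometry σ w) Fw≡M , subst Λ₇ (sym (symmetry∘symmetry⁻¹ σ w)) Λw
      ; from∘to   = λ {v} _ → symmetry⁻¹∘symmetry σ v
      ; to∘from   = λ {w} _ → symmetry∘symmetry⁻¹ σ w
      }

    count-Λ₇ : M ℕ.% 8 ≡ 1 → count (solutions-with-image-in-Λ₇? id) (box M) ≡ r G M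
    count-Λ₇ M≡1 = count-≡ (solutions-with-image-in-Λ₇? id) (λ w → G w ℤ.≟ + M)
      (box-unique M) (box-unique M) (F-solutions-∈-box id) (λ {w} → G-solution-∈-box {M} {w}) (φ-ψ-inverse M≡1)

    reps-identity : M ℕ.% 8 ≡ 1 → ∀ k → (∀ v → F v ≡ + M → Λ₇-images v ≡ k) → k ℕ.* r F M ≡ 8 ℕ.* r G M
    reps-identity M≡1 k k-images = begin
      k ℕ.* r F M
        ≡⟨ sum-count-× F≡M? (λ σ v → Λ₇? (symmetry σ v)) k symmetries k-images (box M) ⟨
      sum (map (λ σ → count (solutions-with-image-in-Λ₇? (symmetry σ)) (box M)) symmetries)
        ≡⟨ cong sum (map-cong (λ σ → trans (count-symmetry σ) (count-Λ₇ M≡1)) symmetries) ⟩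
      sum (map (λ _ → r G M) symmetries)
        ≡⟨⟩
      8 ℕ.* r G M ∎
      where open ≡-Reasoning

open import Data.Nat using (ℕ; _%_; _*_; _>_)
open import Data.Nat.Properties using (*-cancelˡ-≡; *-assoc; *-identityˡ)
open import Data.Integer using (+_)
open import Data.Product using (_×_; _,_)
open import Relation.Binary.PropositionalEquality using (_≡_; module ≡-Reasoning)

-- The hypothesis M > 0 is implied by M ≡ 1 (mod 8).
corollary1p4 : (M : ℕ) → M > 0 → M % 8 ≡ 1 →
    (LegendreMinus1mod7 M → reps (+ 1) (+ 8) (+ 8) (+ 0) (+ 0) (+ 0) M ≡ 4 * reps (+ 3) (+ 5) (+ 14) (+ 0) (+ 0) (+ 2) M)
    × (SevenExactly M → reps (+ 1) (+ 8) (+ 8) (+ 0) (+ 0) (+ 0) M ≡ 8 * reps (+ 3) (+ 5) (+ 14) (+ 0) (+ 0) (+ 2) M)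
corollary1p4 M _ M≡1 = nonresidue-case , sevenExactly-case
  where
  open ≡-Reasoning
  nonresidue-case : LegendreMinus1mod7 M → r F M ≡ 4 * r G M
  nonresidue-case nonresidue = *-cancelˡ-≡ (r F M) (4 * r G M) 2 (begin
    2 * r F M       ≡⟨ reps-identity M M≡1 2 (Λ₇-images-nonresidue nonresidue) ⟩
    8 * r G M       ≡⟨ *-assoc 2 4 (r G M) ⟩
    2 * (4 * r G M) ∎)
  sevenExactly-case : SevenExactly M → r F M ≡ 8 * r G M
  sevenExactly-case sevenExactly = begin
    r F M     ≡⟨ *-identityˡ (r F M) ⟨
    1 * r F M ≡⟨ reps-identity M M≡1 1 (Λ₇-images-sevenExactly sevenExactly) ⟩
    8 * r G M ∎
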